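{- If $G$ is a graph and $t\geq 2$, then $\iota(S_G^t) \leq \xi(S_G^2)\cdot n(G)^{t-2}$.
   Context: All graphs are finite and simple, $n(G)=|V(G)|$. For a graph $G=(V,E)$ and integer $t\ge1$, the generalized Sierpiński graph $S_G^t$ has vertex set $V^t$ (words $u_1\ldots u_t$), and $u=u_1\ldots u_t$, $v=v_1\ldots v_t$ are adjacent iff there is $i\in[t]$ with $u_j=v_j$ for $j<i$, $u_i\ne v_i$ and $u_iv_i\in E$, and $u_j=v_i$, $v_j=u_i$ for all $j>i$. Vertices $xx\ldots x$ are extreme vertices. A set $A$ of vertices is isolating if no two vertices outside the closed neighborhood $N[A]$ are adjacent; $\iota$ is the minimum size of an isolating set and $\gamma$ the domination number. Let $\mathcal{I}(S_G^2)$ be the set of isolating sets $D$ of $S_G^2$ with $|D|\le\gamma(S_G^2)$, and $\xi(S_G^2)=\min\{|D|: D\in\mathcal{I}(S_G^2)$ such that whenever $ii,jj\in V(S_G^2)-N[D]$ we have $ij\notin E(G)\}$. -}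

module Defs where

open import Data.Nat using (ℕ; _≤_; _*_; _∸_; _^_)
open import Data.Fin as F using (Fin)
open import Data.Vec using (Vec; lookup; _∷_; [])
open import Data.List using (List; length)
open import Data.List.Membership.Propositional using (_∈_)
open import Data.List.Relation.Unary.Unique.Propositional using (Unique)
open import Data.Product using (Σ; _×_; ∃-syntax)
open import Data.Sum using (_⊎_)
open import Relation.Nullary using (¬_)
open import Relation.Binary.PropositionalEquality using (_≡_; _≢_)
open import Relation.Binary using (Decidable)

record Graph : Set₁ where
  field
    n      : ℕ
    Adj    : Fin n → Fin n → Set
    adj?   : Decidable Adj
    irrefl : ∀ i → ¬ Adj i i
    sym    : ∀ i j → Adj i j → Adj j i

-- Generalized Sierpinski graph S_G^t: vertices are words of length t,
-- adjacency exactly as in the paper (positions indexed 0..t-1).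
module _ (G : Graph) where
  open Graph G

  SVertex : ℕ → Set
  SVertex t = Vec (Fin n) t

  SAdj : (t : ℕ) → SVertex t → SVertex t → Set
  SAdj t u v = Σ (Fin t) λ i →
      (∀ j → j F.< i → lookup u j ≡ lookup v j)
    × lookup u i ≢ lookup v i
    × Adj (lookup u i) (lookup v i)
    × (∀ j → i F.< j → (lookup u j ≡ lookup v i) × (lookup v j ≡ lookup u i))

-- Generic notions for a graph given by a vertex type V and adjacency E.
-- Vertex sets are duplicate-free lists; their size is the length.
module _ {V : Set} (E : V → V → Set) where

  InClosedNbhd : List V → V → Set
  InClosedNbhd D x = ∃[ d ] (d ∈ D × (d ≡ x ⊎ E d x))

  IsDominating : List V → Set
  IsDominating D = ∀ x → InClosedNbhd D x

  IsIsolating : List V → Set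
  IsIsolating D = ∀ x y → ¬ InClosedNbhd D x → ¬ InClosedNbhd D y → ¬ E x y

IsMinSize : {V : Set} → (List V → Set) → ℕ → Set
IsMinSize {V} P k =
    (∃[ D ] (Unique D × P D × length D ≡ k))
  × (∀ (D : List V) → Unique D → P D → k ≤ length D)

module _ (G : Graph) where
  open Graph G

  IsIsolationNumber : ℕ → ℕ → Set
  IsIsolationNumber t k = IsMinSize (IsIsolating (SAdj G t)) k

  IsDominationNumber : ℕ → ℕ → Set
  IsDominationNumber t k = IsMinSize (IsDominating (SAdj G t)) k

  ext2 : Fin n → SVertex G 2
  ext2 i = i ∷ i ∷ []

  -- D ∈ 𝓘(S_G^2) (given γ = γ(S_G^2)) and D satisfies the extra condition of ξ
  XiAdmissible : ℕ → List (SVertex G 2) → Set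
  XiAdmissible γ D =
      IsIsolating (SAdj G 2) D
    × length D ≤ γ
    × (∀ i j → ¬ InClosedNbhd (SAdj G 2) D (ext2 i)
             → ¬ InClosedNbhd (SAdj G 2) D (ext2 j) → ¬ Adj i j)

  IsXi : ℕ → ℕ → Set
  IsXi γ k = IsMinSize (XiAdmissible γ) k

-- Let D be a ξ-set of S_G^2 and put D' = { w d : w ∈ V(G)^(t-2), d ∈ D }, of size ξ · n^(t-2).
-- An edge of S_G^t between words w s and w' s' (with s, s' of length 2) either lies in one copy,
-- and then it is the edge s s' of S_G^2 translated by w = w', or it joins two copies at the first
-- position j where w and w' differ, and then s = w'_j w'_j and s' = w_j w_j are extreme vertices
-- of S_G^2 with w_j w'_j ∈ E(G). If w s and w' s' both lie outside N[D'], then s and s' lie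
-- outside N[D]: in the first case D isolates s s', in the second the ξ-condition rules out the
-- edge w_j w'_j. So D' is isolating and ι(S_G^t) ≤ |D'|.
module Submission where

open import Defs
open import Data.Nat using (ℕ; zero; suc; _+_; _*_; _^_; _≤_; _∸_; s≤s; z≤n)
open import Data.Nat.Properties using (+-comm; *-comm)
open import Data.Fin as Fin using (Fin; zero; suc)
open import Data.Vec using (Vec; []; _∷_; _++_; lookup; replicate; splitAt)
open import Data.Vec.Properties using (∷-injective; ∷-injectiveʳ; ++-injective)
open import Data.List as List using (List; length; map; allFin; cartesianProductWith)
open import Data.List.Properties using (length-++; length-map; length-tabulate)
open import Data.List.Membership.Propositional using (_∈_)
open import Data.List.Membership.Propositional.Properties using (∈-allFin; ∈-cartesianProductWith⁺)
open import Data.List.Relation.Unary.All as All using ()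
open import Data.List.Relation.Unary.Any using (here)
open import Data.List.Relation.Unary.AllPairs as AllPairs using ()
open import Data.List.Relation.Unary.Unique.Propositional using (Unique)
open import Data.List.Relation.Unary.Unique.Propositional.Properties
  using (allFin⁺; cartesianProductWith⁺)
open import Data.Product using (Σ; _×_; _,_; proj₁; proj₂)
open import Data.Sum using (_⊎_; inj₁; inj₂)
open import Function using (_∘_; id)
open import Relation.Nullary using (¬_)
open import Relation.Binary.PropositionalEquality
  using (_≡_; refl; trans; cong; cong₂; subst; module ≡-Reasoning)

length-cartesianProductWith : {A B C : Set} (f : A → B → C) (xs : List A) (ys : List B) →
  length (cartesianProductWith f xs ys) ≡ length xs * length ys
length-cartesianProductWith f List.[] ys = refl
length-cartesianProductWith f (x List.∷ xs) ys = begin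
  length (map (f x) ys List.++ cartesianProductWith f xs ys)
    ≡⟨ length-++ (map (f x) ys) ⟩
  length (map (f x) ys) + length (cartesianProductWith f xs ys)
    ≡⟨ cong₂ _+_ (length-map (f x) ys) (length-cartesianProductWith f xs ys) ⟩
  length ys + length xs * length ys ∎
  where open ≡-Reasoning

allVec : (n k : ℕ) → List (Vec (Fin n) k)
allVec n zero = [] List.∷ List.[]
allVec n (suc k) = cartesianProductWith _∷_ (allFin n) (allVec n k)

∈-allVec : ∀ {n k} (w : Vec (Fin n) k) → w ∈ allVec n k
∈-allVec [] = here refl
∈-allVec (a ∷ w) = ∈-cartesianProductWith⁺ _∷_ (∈-allFin a) (∈-allVec w)

allVec⁺ : ∀ n k → Unique (allVec n k)
allVec⁺ n zero = All.[] AllPairs.∷ AllPairs.[]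
allVec⁺ n (suc k) = cartesianProductWith⁺ _∷_ ∷-injective (allFin⁺ n) (allVec⁺ n k)

length-allVec : ∀ n k → length (allVec n k) ≡ n ^ k
length-allVec n zero = refl
length-allVec n (suc k) =
  trans (length-cartesianProductWith _∷_ (allFin n) (allVec n k))
        (cong₂ _*_ (length-tabulate {n = n} id) (length-allVec n k))

module _ {A : Set} {x : A} where

  lookup-const⇒≡replicate : ∀ {m} (s : Vec A m) → (∀ i → lookup s i ≡ x) → s ≡ replicate m x
  lookup-const⇒≡replicate [] _ = refl
  lookup-const⇒≡replicate (y ∷ s) h = cong₂ _∷_ (h zero) (lookup-const⇒≡replicate s (h ∘ suc))

  ++≡replicate⇒≡replicate : ∀ {k m} (w : Vec A k) {s : Vec A m} →
    w ++ s ≡ replicate (k + m) x → s ≡ replicate m x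
  ++≡replicate⇒≡replicate [] eq = eq
  ++≡replicate⇒≡replicate (y ∷ w) eq = ++≡replicate⇒≡replicate w (∷-injectiveʳ eq)

module _ (G : Graph) where
  open Graph G renaming (sym to Adj-sym)

  SAdj-∷⁺ : ∀ {t} (a : Fin n) {u v : SVertex G t} → SAdj G t u v → SAdj G (suc t) (a ∷ u) (a ∷ v)
  SAdj-∷⁺ a {u} {v} (i , before , differ , adj , after) = suc i , before′ , differ , adj , after′
    where
    before′ : ∀ j → j Fin.< suc i → lookup (a ∷ u) j ≡ lookup (a ∷ v) j
    before′ zero _ = refl
    before′ (suc j) (s≤s j<i) = before j j<i
    after′ : ∀ j → suc i Fin.< j →
      (lookup (a ∷ u) j ≡ lookup v i) × (lookup (a ∷ v) j ≡ lookup u i)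
    after′ (suc j) (s≤s i<j) = after j i<j

  SAdj-∷⁻ : ∀ {t} {a b : Fin n} {u v : SVertex G t} → SAdj G (suc t) (a ∷ u) (b ∷ v) →
    SAdj G t u v ⊎ (Adj a b × u ≡ replicate t b × v ≡ replicate t a)
  SAdj-∷⁻ {u = u} {v} (zero , _ , _ , adj , after) =
    inj₂ ( adj
         , lookup-const⇒≡replicate u (λ j → proj₁ (after (suc j) (s≤s z≤n)))
         , lookup-const⇒≡replicate v (λ j → proj₂ (after (suc j) (s≤s z≤n))))
  SAdj-∷⁻ (suc i , before , differ , adj , after) =
    inj₁ (i , (λ j → before (suc j) ∘ s≤s) , differ , adj , (λ j → after (suc j) ∘ s≤s))

  SAdj-++⁺ : ∀ {k m} (w : Vec (Fin n) k) {s s′ : SVertex G m} →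
    SAdj G m s s′ → SAdj G (k + m) (w ++ s) (w ++ s′)
  SAdj-++⁺ [] = id
  SAdj-++⁺ (a ∷ w) = SAdj-∷⁺ a ∘ SAdj-++⁺ w

  SAdj-++⁻ : ∀ {k m} (w w′ : Vec (Fin n) k) {s s′ : SVertex G m} →
    SAdj G (k + m) (w ++ s) (w′ ++ s′) →
    SAdj G m s s′ ⊎ Σ (Fin k) λ j →
      Adj (lookup w j) (lookup w′ j) × s ≡ replicate m (lookup w′ j) × s′ ≡ replicate m (lookup w j)
  SAdj-++⁻ [] [] = inj₁
  SAdj-++⁻ (a ∷ w) (b ∷ w′) ws~w′s′ with SAdj-∷⁻ ws~w′s′
  ... | inj₂ (adj , eq , eq′) =
    inj₂ (zero , adj , ++≡replicate⇒≡replicate w eq , ++≡replicate⇒≡replicate w′ eq′)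
  ... | inj₁ ws~w′s′-tail with SAdj-++⁻ w w′ ws~w′s′-tail
  ...   | inj₁ s~s′ = inj₁ s~s′
  ...   | inj₂ (j , edge) = inj₂ (suc j , edge)

  -- The extra condition in the definition of ξ; for m = 2, replicate 2 i is the extreme vertex ii.
  UndominatedExtremesIndependent : (m : ℕ) → List (SVertex G m) → Set
  UndominatedExtremesIndependent m D = ∀ i j →
    ¬ InClosedNbhd (SAdj G m) D (replicate m i) →
    ¬ InClosedNbhd (SAdj G m) D (replicate m j) → ¬ Adj i j

  prefixed : ∀ k {m} → List (SVertex G m) → List (SVertex G (k + m))
  prefixed k D = cartesianProductWith _++_ (allVec n k) D

  prefixed⁺ : ∀ k {m} {D : List (SVertex G m)} → Unique D → Unique (prefixed k D)
  prefixed⁺ k D! = cartesianProductWith⁺ _++_ (++-injective _ _) (allVec⁺ n k) D!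

  length-prefixed : ∀ k {m} (D : List (SVertex G m)) → length (prefixed k D) ≡ n ^ k * length D
  length-prefixed k D = trans (length-cartesianProductWith _++_ (allVec n k) D)
                              (cong (_* length D) (length-allVec n k))

  ∈-prefixed : ∀ {k m} (w : Vec (Fin n) k) {D : List (SVertex G m)} {d : SVertex G m} →
    d ∈ D → w ++ d ∈ prefixed k D
  ∈-prefixed w = ∈-cartesianProductWith⁺ _++_ (∈-allVec w)

  InClosedNbhd-prefixed : ∀ {k m} (w : Vec (Fin n) k) {D : List (SVertex G m)} {s : SVertex G m} →
    InClosedNbhd (SAdj G m) D s → InClosedNbhd (SAdj G (k + m)) (prefixed k D) (w ++ s)
  InClosedNbhd-prefixed w (d , d∈D , inj₁ refl) = w ++ d , ∈-prefixed w d∈D , inj₁ refl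
  InClosedNbhd-prefixed w (d , d∈D , inj₂ d~s) = w ++ d , ∈-prefixed w d∈D , inj₂ (SAdj-++⁺ w d~s)

  prefixed-isolating : ∀ k {m} {D : List (SVertex G m)} →
    IsIsolating (SAdj G m) D → UndominatedExtremesIndependent m D →
    IsIsolating (SAdj G (k + m)) (prefixed k D)
  prefixed-isolating k D-isolating D-extremes x y x∉N y∉N x~y
    with splitAt k x | splitAt k y
  ... | w , s , refl | w′ , s′ , refl with SAdj-++⁻ w w′ x~y
  ...   | inj₁ s~s′ =
    D-isolating s s′ (x∉N ∘ InClosedNbhd-prefixed w) (y∉N ∘ InClosedNbhd-prefixed w′) s~s′
  ...   | inj₂ (j , w~w′ , refl , refl) =
    D-extremes (lookup w′ j) (lookup w j)
      (x∉N ∘ InClosedNbhd-prefixed w) (y∉N ∘ InClosedNbhd-prefixed w′) (Adj-sym _ _ w~w′)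

  isolation-number-≤ : ∀ k {m ι} {D : List (SVertex G m)} →
    IsIsolationNumber G (k + m) ι → Unique D →
    IsIsolating (SAdj G m) D → UndominatedExtremesIndependent m D →
    ι ≤ n ^ k * length D
  isolation-number-≤ k {D = D} (_ , ι-minimal) D! D-isolating D-extremes =
    subst (_ ≤_) (length-prefixed k D)
      (ι-minimal (prefixed k D) (prefixed⁺ k D!) (prefixed-isolating k D-isolating D-extremes))

theorem5p1 : (G : Graph) (t : ℕ) → 2 ≤ t →
    (γ ι ξ : ℕ) →
    IsDominationNumber G 2 γ →
    IsIsolationNumber G t ι →
    IsXi G γ ξ →
    ι ≤ ξ * Graph.n G ^ (t ∸ 2)
theorem5p1 G (suc (suc k)) (s≤s (s≤s z≤n)) γ ι ξ _ ι-is
  ((D , D! , (D-isolating , _ , D-extremes) , refl) , _) =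
  subst (ι ≤_) (*-comm (Graph.n G ^ k) (length D))
    (isolation-number-≤ G k ι-is′ D! D-isolating D-extremes)
  where
  ι-is′ : IsIsolationNumber G (k + 2) ι
  ι-is′ = subst (λ t → IsIsolationNumber G t ι) (+-comm 2 k) ι-is
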